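{- For every positive integer $n$, let $\pi(n)$ denote the number of primes less than or equal to $n$. Then \[ \pi(n)=n-1-\sum_{i=2}^{\lfloor\sqrt{n}\rfloor}\left(\left\lfloor\frac{n}{i}\right\rfloor-i+1\right)+\sum_{s=2}^{\lfloor\sqrt{n}\rfloor}(-1)^{s}\sum_{1<i_1<i_2<\dots<i_s\leqslant\lfloor\sqrt{n}\rfloor}\left(\left\lfloor\frac{n}{\operatorname{LCM}(i_1,\dots,i_s)}\right\rfloor-\left\lfloor\frac{i_s^2-1}{\operatorname{LCM}(i_1,\dots,i_s)}\right\rfloor\right), \] where the inner sum runs over all strictly increasing $s$-tuples of integers $i_1<\dots<i_s$ with $1<i_1$ and $i_s\leqslant\lfloor\sqrt n\rfloor$.
   Context: $\lfloor x\rfloor$ denotes the floor of $x$, and $\operatorname{LCM}(i_1,\dots,i_s)$ denotes the least common multiple of the positive integers $i_1,\dots,i_s$. Empty sums are zero. -}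

module Defs where

open import Data.Nat using (ℕ; zero; suc; _+_; _*_; _∸_; _≤?_)
open import Data.Nat.DivMod using (_/_)
open import Data.Nat.LCM using (lcm)
open import Data.Nat.Primality using (prime?)
open import Data.List using (List; []; _∷_; length; filter; map; concatMap; foldr; sum; upTo; applyUpTo; _++_)
open import Data.Integer as ℤ using (ℤ; +_; -_)
open import Relation.Nullary.Decidable using (⌊_⌋)

primeCount : ℕ → ℕ
primeCount n = length (filter prime? (upTo (suc n)))

-- ⌊√n⌋ : the number of r ∈ {1,…,n} with r*r ≤ n  (equals the largest r with r² ≤ n)
isqrt : ℕ → ℕ
isqrt n = length (filter (λ r → r * r ≤? n) (applyUpTo suc n))

-- floor division; the divisor used below is always ≥ 2, the zero case is a dummy
_div_ : ℕ → ℕ → ℕ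
m div zero    = zero
m div (suc d) = m / suc d

range : ℕ → ℕ → List ℕ
range a b = applyUpTo (λ k → a + k) (suc b ∸ a)

-- all sublists of length s of a list (order preserved); applied to the
-- increasing list 2,…,m this enumerates the tuples 1 < i₁ < … < i_s ≤ m
choose : ℕ → List ℕ → List (List ℕ)
choose zero    xs       = [] ∷ []
choose (suc s) []       = []
choose (suc s) (x ∷ xs) = map (x ∷_) (choose s xs) ++ choose (suc s) xs

lcmList : List ℕ → ℕ
lcmList = foldr lcm 1

-- last element of a list (i_s for an increasing tuple); 0 for the empty list
lastOf : List ℕ → ℕ
lastOf []           = 0
lastOf (x ∷ [])     = x
lastOf (x ∷ y ∷ xs) = lastOf (y ∷ xs)

sumℤ : List ℤ → ℤ
sumℤ = foldr ℤ._+_ (+ 0)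

sign : ℕ → ℤ
sign zero    = + 1
sign (suc s) = - sign s

term : ℕ → List ℕ → ℤ
term n is = (+ (n div lcmList is)) ℤ.- (+ ((lastOf is * lastOf is ∸ 1) div lcmList is))

rhs : ℕ → ℤ
rhs n =
  ((+ n) ℤ.- (+ 1))
  ℤ.- sumℤ (map (λ i → ((+ (n div i)) ℤ.- (+ i)) ℤ.+ (+ 1)) (range 2 (isqrt n)))
  ℤ.+ sumℤ (map (λ s → sign s ℤ.* sumℤ (map (term n) (choose s (range 2 (isqrt n)))))
                (range 2 (isqrt n)))

-- Call x marked by i when i ∣ x and i² ≤ x. For an increasing tuple
-- i₁ < … < i_s the difference ⌊n/L⌋ − ⌊(i_s² − 1)/L⌋, L = LCM(i₁,…,i_s),
-- counts the x ≤ n that are marked by every i_j, since i_s² ≤ x is the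
-- strongest of the conditions i_j² ≤ x. Inclusion–exclusion over
-- 2,…,⌊√n⌋, i.e. the expansion ∏ᵢ (1 − cᵢ) = Σ_s (−1)^s e_s(c), therefore
-- counts the x ∈ [1,n] marked by no i ≥ 2, and these are exactly 1 and the
-- primes ≤ n (a composite x = d q has the mark min(d,q)). The terms s = 0
-- and s = 1 of the expansion are n and the first sum of the formula.
module Submission where

open import Defs
open import Data.Nat using (ℕ; _≥_)
open import Data.Integer using (+_)
open import Relation.Binary.PropositionalEquality using (_≡_)

open import Data.Integer as ℤ using (ℤ; -_; _+_; _*_; _-_)
import Data.Integer.Properties as ℤ
open import Data.Integer.Tactic.RingSolver using (solve-∀)
open import Data.List using (List; []; _∷_; [_]; _++_; map; filter; length; applyUpTo; foldr)
import Data.List.Properties as List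
open import Data.List.Membership.Propositional using (_∈_; lose)
open import Data.List.Membership.Propositional.Properties using (∈-applyUpTo⁺)
open import Data.List.Relation.Binary.Sublist.Propositional using (_⊆_; []; _∷_; _∷ʳ_; minimum)
open import Data.List.Relation.Binary.Sublist.Propositional.Properties using (All-resp-⊆)
open import Data.List.Relation.Unary.All as All using (All; []; _∷_; all?)
import Data.List.Relation.Unary.All.Properties as All
open import Data.List.Relation.Unary.AllPairs using (AllPairs; []; _∷_)
import Data.List.Relation.Unary.AllPairs.Properties as AllPairs
open import Data.List.Relation.Unary.Any using (Any; here; there)
open import Data.Nat as ℕ using (zero; suc; _≤_; _<_; z≤n; s≤s; z<s; s<s; _≤?_; _≟_; _∸_; _/_; _%_)
open import Data.Nat.Base using (nonTrivial⇒n>1)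
import Data.Nat.Properties as ℕ
open import Data.Nat.DivMod
  using (m≡m%n+[m/n]*n; m%n<n; /-congˡ; +-distrib-/-∣ˡ; +-distrib-/-∣ʳ; m*n/n≡m; n/n≡1; n/1≡n; m<n⇒m/n≡0)
open import Data.Nat.Divisibility
  using ( _∣_; _∣?_; divides; quotient; n∣m*n; ∣m+n∣m⇒∣n; ∣⇒≤; ∣-trans; ∣-refl; ∣-antisym; 1∣_; ∣1⇒≡1
        ; m∣n⇒n≡quotient*m; quotient-∣; quotient>1)
open import Data.Nat.GCD using (gcd)
open import Data.Nat.LCM using (lcm; m∣lcm[m,n]; n∣lcm[m,n]; lcm-least; gcd*lcm)
open import Data.Nat.Primality using (Composite; composite; prime?; prime⇒irreducible; ¬prime⇒composite)
open import Data.Product using (_×_; _,_; proj₁; proj₂; ∃-syntax)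
open import Data.Sum using (inj₁; inj₂)
open import Function using (_∘_)
open import Function.Bundles using (_⇔_; mk⇔; Equivalence)
open import Relation.Binary.PropositionalEquality using (refl; sym; trans; cong; cong₂; subst; module ≡-Reasoning)
open import Relation.Nullary using (Dec; yes; no; ¬_; contradiction)
open import Relation.Nullary.Decidable using (_×-dec_)
open import Relation.Unary using (Decidable)

open ≡-Reasoning

∑ : ℕ → (ℕ → ℤ) → ℤ
∑ zero    f = + 0
∑ (suc k) f = f 0 + ∑ k (f ∘ suc)

infix 5 ∑
syntax ∑ k (λ i → e) = ∑[ i < k ] e

∑-cong : ∀ k {f g : ℕ → ℤ} → (∀ i → i < k → f i ≡ g i) → ∑ k f ≡ ∑ k g
∑-cong zero    _   = refl
∑-cong (suc k) f≡g = cong₂ _+_ (f≡g 0 z<s) (∑-cong k (λ i → f≡g (suc i) ∘ s<s))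

∑-zero : ∀ k {f : ℕ → ℤ} → (∀ i → i < k → f i ≡ + 0) → ∑ k f ≡ + 0
∑-zero zero    _   = refl
∑-zero (suc k) f≡0 = cong₂ _+_ (f≡0 0 z<s) (∑-zero k (λ i → f≡0 (suc i) ∘ s<s))

∑-split : ∀ m t (f : ℕ → ℤ) → ∑ (m ℕ.+ t) f ≡ ∑ m f + (∑[ i < t ] f (m ℕ.+ i))
∑-split zero    t f = sym (ℤ.+-identityˡ _)
∑-split (suc m) t f = trans (cong (_+_ (f 0)) (∑-split m t (f ∘ suc))) (sym (ℤ.+-assoc (f 0) _ _))

∑-snoc : ∀ k (f : ℕ → ℤ) → ∑ (suc k) f ≡ ∑ k f + f k
∑-snoc k f = begin
  ∑ (suc k) f                ≡⟨ cong (λ m → ∑ m f) (ℕ.+-comm 1 k) ⟩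
  ∑ (k ℕ.+ 1) f              ≡⟨ ∑-split k 1 f ⟩
  ∑ k f + (f (k ℕ.+ 0) + + 0) ≡⟨ cong (_+_ (∑ k f)) (ℤ.+-identityʳ _) ⟩
  ∑ k f + f (k ℕ.+ 0)         ≡⟨ cong (λ i → ∑ k f + f i) (ℕ.+-identityʳ k) ⟩
  ∑ k f + f k                 ∎

∑-distrib-+ : ∀ k (f g : ℕ → ℤ) → ∑[ i < k ] (f i + g i) ≡ ∑ k f + ∑ k g
∑-distrib-+ zero    f g = refl
∑-distrib-+ (suc k) f g =
  trans (cong (_+_ (f 0 + g 0)) (∑-distrib-+ k (f ∘ suc) (g ∘ suc))) (interchange (f 0) (g 0) _ _)
  where
  interchange : ∀ a b c d → (a + b) + (c + d) ≡ (a + c) + (b + d)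
  interchange = solve-∀

*-distribˡ-∑ : ∀ c k (f : ℕ → ℤ) → c * ∑ k f ≡ ∑[ i < k ] c * f i
*-distribˡ-∑ c zero    f = ℤ.*-zeroʳ c
*-distribˡ-∑ c (suc k) f = trans (ℤ.*-distribˡ-+ c (f 0) _) (cong (_+_ (c * f 0)) (*-distribˡ-∑ c k (f ∘ suc)))

∑-comm : ∀ a b (h : ℕ → ℕ → ℤ) → ∑[ i < a ] ∑[ j < b ] h i j ≡ ∑[ j < b ] ∑[ i < a ] h i j
∑-comm zero    b h = sym (∑-zero b (λ _ _ → refl))
∑-comm (suc a) b h =
  trans (cong (_+_ (∑ b (h 0))) (∑-comm a b (h ∘ suc))) (sym (∑-distrib-+ b (h 0) _))

sumℤ-++ : ∀ xs ys → sumℤ (xs ++ ys) ≡ sumℤ xs + sumℤ ys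
sumℤ-++ []       ys = sym (ℤ.+-identityˡ _)
sumℤ-++ (x ∷ xs) ys = trans (cong (_+_ x) (sumℤ-++ xs ys)) (sym (ℤ.+-assoc x _ _))

*-distribˡ-sumℤ : ∀ c xs → c * sumℤ xs ≡ sumℤ (map (c *_) xs)
*-distribˡ-sumℤ c []       = ℤ.*-zeroʳ c
*-distribˡ-sumℤ c (x ∷ xs) = trans (ℤ.*-distribˡ-+ c x _) (cong (_+_ (c * x)) (*-distribˡ-sumℤ c xs))

sumℤ-map-applyUpTo : ∀ (f : ℕ → ℤ) g k → sumℤ (map f (applyUpTo g k)) ≡ ∑[ i < k ] f (g i)
sumℤ-map-applyUpTo f g zero    = refl
sumℤ-map-applyUpTo f g (suc k) = cong (_+_ (f (g 0))) (sumℤ-map-applyUpTo f (g ∘ suc) k)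

sumℤ-map-∑ : ∀ {A : Set} (h : A → ℕ → ℤ) xs k →
  sumℤ (map (λ x → ∑ k (h x)) xs) ≡ ∑[ i < k ] sumℤ (map (λ x → h x i) xs)
sumℤ-map-∑ h []       k = sym (∑-zero k (λ _ _ → refl))
sumℤ-map-∑ h (x ∷ xs) k =
  trans (cong (_+_ (∑ k (h x))) (sumℤ-map-∑ h xs k)) (sym (∑-distrib-+ k (h x) _))

productℤ : List ℤ → ℤ
productℤ = foldr _*_ (+ 1)

𝟙 : {A : Set} → Dec A → ℤ
𝟙 (yes _) = + 1
𝟙 (no _)  = + 0

𝟙-cong : {A B : Set} → A ⇔ B → (a : Dec A) (b : Dec B) → 𝟙 a ≡ 𝟙 b
𝟙-cong A⇔B (yes _) (yes _) = refl
𝟙-cong A⇔B (yes a) (no ¬b) = contradiction (Equivalence.to A⇔B a) ¬b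
𝟙-cong A⇔B (no ¬a) (yes b) = contradiction (Equivalence.from A⇔B b) ¬a
𝟙-cong A⇔B (no _)  (no _)  = refl

𝟙-yes : {A : Set} → A → (a : Dec A) → 𝟙 a ≡ + 1
𝟙-yes _ (yes _) = refl
𝟙-yes a (no ¬a) = contradiction a ¬a

𝟙-no : {A : Set} → ¬ A → (a : Dec A) → 𝟙 a ≡ + 0
𝟙-no ¬a (yes a) = contradiction a ¬a
𝟙-no _  (no _)  = refl

𝟙-× : {A B : Set} (a : Dec A) (b : Dec B) → 𝟙 (a ×-dec b) ≡ 𝟙 a * 𝟙 b
𝟙-× (yes _) (yes _) = refl
𝟙-× (yes _) (no _)  = refl
𝟙-× (no _)  (yes _) = refl
𝟙-× (no _)  (no _)  = refl

𝟙-all : ∀ {A : Set} {P : A → Set} (P? : Decidable P) xs → 𝟙 (all? P? xs) ≡ productℤ (map (𝟙 ∘ P?) xs)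
𝟙-all P? []       = refl
𝟙-all P? (x ∷ xs) = begin
  𝟙 (all? P? (x ∷ xs))
    ≡⟨ 𝟙-cong (mk⇔ All.uncons (λ (p , ps) → p ∷ ps)) (all? P? (x ∷ xs)) (P? x ×-dec all? P? xs) ⟩
  𝟙 (P? x ×-dec all? P? xs)       ≡⟨ 𝟙-× (P? x) (all? P? xs) ⟩
  𝟙 (P? x) * 𝟙 (all? P? xs)       ≡⟨ cong (𝟙 (P? x) *_) (𝟙-all P? xs) ⟩
  productℤ (map (𝟙 ∘ P?) (x ∷ xs)) ∎

length-filter-applyUpTo : ∀ {P : ℕ → Set} (P? : Decidable P) f k →
  + length (filter P? (applyUpTo f k)) ≡ ∑[ i < k ] 𝟙 (P? (f i))
length-filter-applyUpTo P? f zero = refl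
length-filter-applyUpTo P? f (suc k) with P? (f 0)
... | yes _ = cong (_+_ (+ 1)) (length-filter-applyUpTo P? (f ∘ suc) k)
... | no _  = trans (length-filter-applyUpTo P? (f ∘ suc) k) (sym (ℤ.+-identityˡ _))

productℤ-complement-none : ∀ {A : Set} {P : A → Set} (P? : Decidable P) {xs} →
  All (¬_ ∘ P) xs → productℤ (map (λ x → + 1 - 𝟙 (P? x)) xs) ≡ + 1
productℤ-complement-none P? []               = refl
productℤ-complement-none P? {x ∷ _} (¬p ∷ ¬ps) =
  cong₂ (λ c r → (+ 1 - c) * r) (𝟙-no ¬p (P? x)) (productℤ-complement-none P? ¬ps)

productℤ-complement-any : ∀ {A : Set} {P : A → Set} (P? : Decidable P) {xs} →
  Any P xs → productℤ (map (λ x → + 1 - 𝟙 (P? x)) xs) ≡ + 0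
productℤ-complement-any P? {x ∷ xs} (here p) =
  trans (cong (λ c → (+ 1 - c) * rest) (𝟙-yes p (P? x))) (ℤ.*-zeroˡ rest)
  where
  rest = productℤ (map (λ y → + 1 - 𝟙 (P? y)) xs)
productℤ-complement-any P? {x ∷ xs} (there p) =
  trans (cong ((+ 1 - 𝟙 (P? x)) *_) (productℤ-complement-any P? p)) (ℤ.*-zeroʳ (+ 1 - 𝟙 (P? x)))

elementary : (ℕ → ℤ) → List ℕ → ℕ → ℤ
elementary c L s = sumℤ (map (productℤ ∘ map c) (choose s L))

AllPairs-resp-⊆ : ∀ {A : Set} {R : A → A → Set} {xs ys} → xs ⊆ ys → AllPairs R ys → AllPairs R xs
AllPairs-resp-⊆ []         []        = []
AllPairs-resp-⊆ (_ ∷ʳ xs⊆ys) (_ ∷ Rys) = AllPairs-resp-⊆ xs⊆ys Rys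
AllPairs-resp-⊆ (refl ∷ xs⊆ys) (Ry ∷ Rys) = All-resp-⊆ xs⊆ys Ry ∷ AllPairs-resp-⊆ xs⊆ys Rys

choose-⊆ : ∀ s xs → All (_⊆ xs) (choose s xs)
choose-⊆ zero    xs       = minimum xs ∷ []
choose-⊆ (suc s) []       = []
choose-⊆ (suc s) (x ∷ xs) =
  All.++⁺ (All.map⁺ (All.map (refl ∷_) (choose-⊆ s xs))) (All.map (x ∷ʳ_) (choose-⊆ (suc s) xs))

choose-1 : ∀ xs → choose 1 xs ≡ map [_] xs
choose-1 []       = refl
choose-1 (x ∷ xs) = cong ([ x ] ∷_) (choose-1 xs)

elementary-∷ : ∀ (c : ℕ → ℤ) x xs s →
  elementary c (x ∷ xs) (suc s) ≡ c x * elementary c xs s + elementary c xs (suc s)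
elementary-∷ c x xs s = begin
  sumℤ (map e (map (x ∷_) (choose s xs) ++ choose (suc s) xs))
    ≡⟨ cong sumℤ (List.map-++ e (map (x ∷_) (choose s xs)) _) ⟩
  sumℤ (map e (map (x ∷_) (choose s xs)) ++ map e (choose (suc s) xs))
    ≡⟨ sumℤ-++ (map e (map (x ∷_) (choose s xs))) _ ⟩
  sumℤ (map e (map (x ∷_) (choose s xs))) + elementary c xs (suc s)
    ≡⟨ cong (λ ys → sumℤ ys + elementary c xs (suc s)) (List.map-∘ {g = e} {f = x ∷_} (choose s xs)) ⟨
  sumℤ (map (e ∘ (x ∷_)) (choose s xs)) + elementary c xs (suc s)
    ≡⟨ cong (λ ys → sumℤ ys + elementary c xs (suc s)) (List.map-∘ {g = c x *_} {f = e} (choose s xs)) ⟩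
  sumℤ (map (c x *_) (map e (choose s xs))) + elementary c xs (suc s)
    ≡⟨ cong (_+ elementary c xs (suc s)) (*-distribˡ-sumℤ (c x) (map e (choose s xs))) ⟨
  c x * elementary c xs s + elementary c xs (suc s) ∎
  where
  e = productℤ ∘ map c

inclusion-exclusion : ∀ (c : ℕ → ℤ) L K → length L ≤ K →
  ∑[ s < suc K ] sign s * elementary c L s ≡ productℤ (map (λ x → + 1 - c x) L)
inclusion-exclusion c []       K _ = cong (_+_ (+ 1)) (∑-zero K (λ s _ → ℤ.*-zeroʳ (sign (suc s))))
inclusion-exclusion c (x ∷ xs) (suc K) (s≤s |xs|≤K) = begin
  E 0 + (∑[ s < suc K ] sign (suc s) * elementary c (x ∷ xs) (suc s))
    ≡⟨ cong (_+_ (E 0)) (∑-cong (suc K) (λ s _ → step s)) ⟩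
  E 0 + (∑[ s < suc K ] (E (suc s) + (- c x) * E s))
    ≡⟨ cong (_+_ (E 0)) (∑-distrib-+ (suc K) (E ∘ suc) (λ s → (- c x) * E s)) ⟩
  E 0 + (∑ (suc K) (E ∘ suc) + (∑[ s < suc K ] (- c x) * E s))
    ≡⟨ ℤ.+-assoc (E 0) (∑ (suc K) (E ∘ suc)) _ ⟨
  ∑ (suc (suc K)) E + (∑[ s < suc K ] (- c x) * E s)
    ≡⟨ cong (_+_ (∑ (suc (suc K)) E)) (*-distribˡ-∑ (- c x) (suc K) E) ⟨
  ∑ (suc (suc K)) E + (- c x) * ∑ (suc K) E
    ≡⟨ cong₂ (λ a b → a + (- c x) * b)
             (inclusion-exclusion c xs (suc K) (ℕ.m≤n⇒m≤1+n |xs|≤K)) (inclusion-exclusion c xs K |xs|≤K) ⟩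
  P + (- c x) * P
    ≡⟨ factor (c x) P ⟩
  (+ 1 - c x) * P ∎
  where
  E : ℕ → ℤ
  E s = sign s * elementary c xs s
  P = productℤ (map (λ y → + 1 - c y) xs)
  regroup : ∀ t a e e′ → (- t) * (a * e + e′) ≡ (- t) * e′ + (- a) * (t * e)
  regroup = solve-∀
  step : ∀ s → sign (suc s) * elementary c (x ∷ xs) (suc s) ≡ E (suc s) + (- c x) * E s
  step s = trans (cong (sign (suc s) *_) (elementary-∷ c x xs s)) (regroup (sign s) (c x) _ _)
  factor : ∀ a p → p + (- a) * p ≡ (+ 1 - a) * p
  factor = solve-∀

1+n≡[n/D]*D+[1+n%D] : ∀ d n → suc n ≡ n / suc d ℕ.* suc d ℕ.+ suc (n % suc d)
1+n≡[n/D]*D+[1+n%D] d n = begin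
  suc n                     ≡⟨ cong suc (m≡m%n+[m/n]*n n (suc d)) ⟩
  suc (n % suc d ℕ.+ q*D)   ≡⟨ cong suc (ℕ.+-comm (n % suc d) q*D) ⟩
  suc (q*D ℕ.+ n % suc d)   ≡⟨ ℕ.+-suc q*D (n % suc d) ⟨
  q*D ℕ.+ suc (n % suc d)   ∎
  where
  q*D = n / suc d ℕ.* suc d

suc-/ : ∀ d n → suc n / suc d ≡ n / suc d ℕ.+ suc (n % suc d) / suc d
suc-/ d n = begin
  suc n / suc d                                    ≡⟨ /-congˡ {o = suc d} (1+n≡[n/D]*D+[1+n%D] d n) ⟩
  (q ℕ.* suc d ℕ.+ suc (n % suc d)) / suc d        ≡⟨ +-distrib-/-∣ˡ (suc (n % suc d)) (n∣m*n q) ⟩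
  q ℕ.* suc d / suc d ℕ.+ suc (n % suc d) / suc d  ≡⟨ cong (ℕ._+ suc (n % suc d) / suc d) (m*n/n≡m q (suc d)) ⟩
  q ℕ.+ suc (n % suc d) / suc d                    ∎
  where
  q = n / suc d

∣suc⇔ : ∀ d n → suc d ∣ suc n ⇔ suc (n % suc d) ≡ suc d
∣suc⇔ d n = mk⇔ to from
  where
  q = n / suc d
  to : suc d ∣ suc n → suc (n % suc d) ≡ suc d
  to D∣1+n = ℕ.≤-antisym (m%n<n n (suc d))
    (∣⇒≤ (∣m+n∣m⇒∣n (subst (suc d ∣_) (1+n≡[n/D]*D+[1+n%D] d n) D∣1+n) (n∣m*n q)))
  from : suc (n % suc d) ≡ suc d → suc d ∣ suc n
  from 1+r≡D = divides (suc q) (begin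
    suc n                               ≡⟨ 1+n≡[n/D]*D+[1+n%D] d n ⟩
    q ℕ.* suc d ℕ.+ suc (n % suc d)     ≡⟨ cong (q ℕ.* suc d ℕ.+_) 1+r≡D ⟩
    q ℕ.* suc d ℕ.+ suc d               ≡⟨ ℕ.+-comm (q ℕ.* suc d) (suc d) ⟩
    suc q ℕ.* suc d                     ∎)

suc-/-step : ∀ d n → + (suc n / suc d) ≡ + (n / suc d) + 𝟙 (suc d ∣? suc n)
suc-/-step d n with suc d ∣? suc n
... | yes D∣1+n = cong +_ (trans (suc-/ d n) (cong (n / suc d ℕ.+_) [1+r]/D≡1))
  where
  [1+r]/D≡1 : suc (n % suc d) / suc d ≡ 1
  [1+r]/D≡1 = trans (/-congˡ {o = suc d} (Equivalence.to (∣suc⇔ d n) D∣1+n)) (n/n≡1 (suc d))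
... | no D∤1+n = cong +_ (trans (suc-/ d n) (cong (n / suc d ℕ.+_) [1+r]/D≡0))
  where
  [1+r]/D≡0 : suc (n % suc d) / suc d ≡ 0
  [1+r]/D≡0 = m<n⇒m/n≡0 (ℕ.≤∧≢⇒< (m%n<n n (suc d)) (D∤1+n ∘ Equivalence.from (∣suc⇔ d n)))

count-multiples : ∀ d n → + (n / suc d) ≡ ∑[ k < n ] 𝟙 (suc d ∣? suc k)
count-multiples d zero    = refl
count-multiples d (suc n) = begin
  + (suc n / suc d)                   ≡⟨ suc-/-step d n ⟩
  + (n / suc d) + 𝟙 (suc d ∣? suc n)  ≡⟨ cong (_+ 𝟙 (suc d ∣? suc n)) (count-multiples d n) ⟩
  ∑ n f + f n                         ≡⟨ ∑-snoc n f ⟨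
  ∑ (suc n) f                         ∎
  where
  f : ℕ → ℤ
  f k = 𝟙 (suc d ∣? suc k)

count-multiples-from : ∀ d {a n} → a ≤ n →
  + (n / suc d) - + ((a ∸ 1) / suc d) ≡ ∑[ k < n ] 𝟙 (suc d ∣? suc k ×-dec a ≤? suc k)
count-multiples-from d {a} a≤n with ℕ.m≤n⇒∃[o]m+o≡n (ℕ.≤-trans (ℕ.m∸n≤m a 1) a≤n)
... | t , refl = begin
  + ((b ℕ.+ t) / suc d) - + (b / suc d)          ≡⟨ cong₂ _-_ (count-multiples d (b ℕ.+ t)) (count-multiples d b) ⟩
  ∑ (b ℕ.+ t) f - ∑ b f                          ≡⟨ cong (_- ∑ b f) (∑-split b t f) ⟩
  (∑ b f + (∑[ k < t ] f (b ℕ.+ k))) - ∑ b f     ≡⟨ cancel (∑ b f) _ ⟩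
  ∑[ k < t ] f (b ℕ.+ k)                         ≡⟨ ∑-cong t (λ k _ → f≡g-from-b k) ⟩
  ∑[ k < t ] g (b ℕ.+ k)                         ≡⟨ ℤ.+-identityˡ _ ⟨
  + 0 + (∑[ k < t ] g (b ℕ.+ k))                 ≡⟨ cong (_+ (∑[ k < t ] g (b ℕ.+ k))) (∑-zero b g-below-b) ⟨
  ∑ b g + (∑[ k < t ] g (b ℕ.+ k))               ≡⟨ ∑-split b t g ⟨
  ∑ (b ℕ.+ t) g                                  ∎
  where
  b = a ∸ 1
  f? = λ k → suc d ∣? suc k
  g? = λ k → suc d ∣? suc k ×-dec a ≤? suc k
  f g : ℕ → ℤ
  f = 𝟙 ∘ f?
  g = 𝟙 ∘ g?
  g-below-b : ∀ k → k < b → g k ≡ + 0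
  g-below-b k k<b = 𝟙-no (λ (_ , a≤1+k) → ℕ.<⇒≱ k<b (ℕ.∸-monoˡ-≤ 1 a≤1+k)) (g? k)
  f≡g-from-b : ∀ k → f (b ℕ.+ k) ≡ g (b ℕ.+ k)
  f≡g-from-b k = 𝟙-cong (mk⇔ (_, a≤1+b+k) proj₁) (f? (b ℕ.+ k)) (g? (b ℕ.+ k))
    where
    a≤1+b+k : a ≤ suc (b ℕ.+ k)
    a≤1+b+k = ℕ.≤-trans (ℕ.m≤n+m∸n a 1) (s≤s (ℕ.m≤m+n b k))
  cancel : ∀ x y → (x + y) - x ≡ y
  cancel = solve-∀

Marked : ℕ → ℕ → Set
Marked x i = i ∣ x × i ℕ.* i ≤ x

marked? : ∀ x i → Dec (Marked x i)
marked? x i = i ∣? x ×-dec i ℕ.* i ≤? x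

JointlyMarked : ℕ → List ℕ → Set
JointlyMarked x S = lcmList S ∣ x × lastOf S ℕ.* lastOf S ≤ x

jointlyMarked? : ∀ x S → Dec (JointlyMarked x S)
jointlyMarked? x S = lcmList S ∣? x ×-dec lastOf S ℕ.* lastOf S ≤? x

lastOf-All : ∀ {P : ℕ → Set} {x xs} → All P (x ∷ xs) → P (lastOf (x ∷ xs))
lastOf-All (p ∷ [])         = p
lastOf-All (_ ∷ ps@(_ ∷ _)) = lastOf-All ps

lastOf-square≤ : ∀ {n} S → All (λ i → i ℕ.* i ≤ n) S → lastOf S ℕ.* lastOf S ≤ n
lastOf-square≤ []      []  = z≤n
lastOf-square≤ (_ ∷ _) i²≤n = lastOf-All i²≤n

square-mono : ∀ {i j} → i ≤ j → i ℕ.* i ≤ j ℕ.* j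
square-mono i≤j = ℕ.*-mono-≤ i≤j i≤j

jointlyMarked⇔allMarked : ∀ {x} S → AllPairs _≤_ S → JointlyMarked x S ⇔ All (Marked x) S
jointlyMarked⇔allMarked {x} [] _ = mk⇔ (λ _ → []) (λ _ → 1∣ x , z≤n)
jointlyMarked⇔allMarked {x} (y ∷ []) _ = mk⇔
  (λ (l∣x , y²≤x) → (∣-trans (m∣lcm[m,n] y 1) l∣x , y²≤x) ∷ [])
  (λ { ((y∣x , y²≤x) ∷ []) → lcm-least y∣x (1∣ x) , y²≤x })
jointlyMarked⇔allMarked {x} (y ∷ S@(_ ∷ _)) (y≤S ∷ sorted) = mk⇔ to from
  where
  module IH = Equivalence (jointlyMarked⇔allMarked S sorted)
  to : JointlyMarked x (y ∷ S) → All (Marked x) (y ∷ S)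
  to (l∣x , last²≤x) =
    (∣-trans (m∣lcm[m,n] y _) l∣x , ℕ.≤-trans (square-mono (lastOf-All y≤S)) last²≤x)
    ∷ IH.to (∣-trans (n∣lcm[m,n] y _) l∣x , last²≤x)
  from : All (Marked x) (y ∷ S) → JointlyMarked x (y ∷ S)
  from ((y∣x , _) ∷ marks) = let (L∣x , last²≤x) = IH.from marks in lcm-least y∣x L∣x , last²≤x

lcm-pos : ∀ {m n} → 1 ≤ m → 1 ≤ n → 1 ≤ lcm m n
lcm-pos {m} {n} 1≤m 1≤n with lcm m n | gcd*lcm m n
... | suc _ | _   = s≤s z≤n
... | zero  | g*0≡m*n =
  contradiction (trans (sym (ℕ.*-zeroʳ (gcd m n))) g*0≡m*n) (ℕ.<⇒≢ (ℕ.*-mono-≤ 1≤m 1≤n))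

lcmList-pos : ∀ {S} → All (1 ≤_) S → 1 ≤ lcmList S
lcmList-pos []           = s≤s z≤n
lcmList-pos (1≤i ∷ 1≤S) = lcm-pos 1≤i (lcmList-pos 1≤S)

term≡∑-jointlyMarked : ∀ n S → 1 ≤ lcmList S → lastOf S ℕ.* lastOf S ≤ n →
  term n S ≡ ∑[ k < n ] 𝟙 (jointlyMarked? (suc k) S)
term≡∑-jointlyMarked n S 1≤L last²≤n with lcmList S | 1≤L
... | suc d | _ = count-multiples-from d last²≤n

term≡∑-allMarked : ∀ n S → AllPairs _≤_ S → All (1 ≤_) S → All (λ i → i ℕ.* i ≤ n) S →
  term n S ≡ ∑[ k < n ] productℤ (map (𝟙 ∘ marked? (suc k)) S)
term≡∑-allMarked n S sorted 1≤S i²≤n = begin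
  term n S
    ≡⟨ term≡∑-jointlyMarked n S (lcmList-pos 1≤S) (lastOf-square≤ S i²≤n) ⟩
  ∑[ k < n ] 𝟙 (jointlyMarked? (suc k) S)
    ≡⟨ ∑-cong n (λ k _ → 𝟙-cong (jointlyMarked⇔allMarked S sorted) _ (all? (marked? (suc k)) S)) ⟩
  ∑[ k < n ] 𝟙 (all? (marked? (suc k)) S)
    ≡⟨ ∑-cong n (λ k _ → 𝟙-all (marked? (suc k)) S) ⟩
  ∑[ k < n ] productℤ (map (𝟙 ∘ marked? (suc k)) S) ∎

composite⇒marked : ∀ {x} → Composite x → ∃[ i ] (2 ≤ i × Marked x i)
composite⇒marked (composite {d} d<x d∣x) with ℕ.≤-total d (quotient d∣x)
... | inj₁ d≤q = d , nonTrivial⇒n>1 d , d∣x ,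
  ℕ.≤-trans (ℕ.*-monoˡ-≤ d d≤q) (ℕ.≤-reflexive (sym (m∣n⇒n≡quotient*m d∣x)))
... | inj₂ q≤d = quotient d∣x , quotient>1 d∣x d<x , quotient-∣ d∣x ,
  ℕ.≤-trans (ℕ.*-monoʳ-≤ (quotient d∣x) q≤d) (ℕ.≤-reflexive (sym (m∣n⇒n≡quotient*m d∣x)))

productℤ-unmarked : ∀ {n} R → All (2 ≤_) R → (∀ {i} → 2 ≤ i → i ℕ.* i ≤ n → i ∈ R) →
  ∀ {x} → 1 ≤ x → x ≤ n → productℤ (map (λ i → + 1 - 𝟙 (marked? x i)) R) ≡ 𝟙 (prime? x) + 𝟙 (x ≟ 1)
productℤ-unmarked R 2≤R _ {1} _ _ =
  productℤ-complement-none (marked? 1) (All.map (λ 2≤i (i∣1 , _) → ℕ.<⇒≢ 2≤i (sym (∣1⇒≡1 i∣1))) 2≤R)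
productℤ-unmarked R 2≤R covers {x@(suc (suc _))} _ x≤n with prime? x
... | yes x-prime = productℤ-complement-none (marked? x) (All.map unmarked 2≤R)
  where
  unmarked : ∀ {i} → 2 ≤ i → ¬ Marked x i
  unmarked 2≤i (i∣x , i²≤x) with prime⇒irreducible x-prime i∣x
  ... | inj₁ i≡1  = ℕ.<⇒≢ 2≤i (sym i≡1)
  ... | inj₂ refl = ℕ.<⇒≱ (ℕ.m<m*n x x (s≤s (s≤s z≤n))) i²≤x
... | no ¬x-prime =
  let (i , 2≤i , i-marks-x) = composite⇒marked (¬prime⇒composite ¬x-prime)
  in productℤ-complement-any (marked? x) (lose (covers 2≤i (ℕ.≤-trans (proj₂ i-marks-x) x≤n)) i-marks-x)

module _ {P : ℕ → Set} (P? : Decidable P) where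

  countUpTo : ℕ → ℕ
  countUpTo k = length (filter P? (applyUpTo suc k))

  countUpTo≤ : ∀ k → countUpTo k ≤ k
  countUpTo≤ k = ℕ.≤-trans (List.length-filter P? (applyUpTo suc k)) (ℕ.≤-reflexive (List.length-applyUpTo suc k))

  countUpTo-reject : ∀ k → ¬ P (suc k) → countUpTo (suc k) ≡ countUpTo k
  countUpTo-reject k ¬p = begin
    length (filter P? (applyUpTo suc (suc k)))    ≡⟨ cong (length ∘ filter P?) (List.applyUpTo-∷ʳ suc k) ⟨
    length (filter P? (xs ++ [ suc k ]))          ≡⟨ cong length (List.filter-++ P? xs [ suc k ]) ⟩
    length (filter P? xs ++ filter P? [ suc k ])  ≡⟨ List.length-++ (filter P? xs) ⟩
    countUpTo k ℕ.+ length (filter P? [ suc k ])  ≡⟨ cong (λ ys → countUpTo k ℕ.+ length ys) (List.filter-reject P? ¬p) ⟩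
    countUpTo k ℕ.+ 0                             ≡⟨ ℕ.+-identityʳ (countUpTo k) ⟩
    countUpTo k                                   ∎
    where
    xs = applyUpTo suc k

  P⇔≤countUpTo : (∀ {i j} → i ≤ j → P j → P i) → ∀ k {r} → 1 ≤ r → r ≤ k → P r ⇔ r ≤ countUpTo k
  P⇔≤countUpTo downClosed zero    1≤r r≤0   = contradiction r≤0 (ℕ.<⇒≱ 1≤r)
  P⇔≤countUpTo downClosed (suc k) {r} 1≤r r≤1+k with P? (suc k)
  ... | yes p = mk⇔ (λ _ → subst (r ≤_) (sym allAccepted) r≤1+k) (λ _ → downClosed r≤1+k p)
    where
    allAccepted : countUpTo (suc k) ≡ suc k
    allAccepted = trans (cong length (List.filter-all P? (All.applyUpTo⁺₁ suc (suc k) (λ i<1+k → downClosed i<1+k p))))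
                        (List.length-applyUpTo suc (suc k))
  ... | no ¬p with ℕ.m≤n⇒m<n∨m≡n r≤1+k
  ...   | inj₁ (s≤s r≤k) =
    subst (λ c → P r ⇔ r ≤ c) (sym (countUpTo-reject k ¬p)) (P⇔≤countUpTo downClosed k 1≤r r≤k)
  ...   | inj₂ refl      = mk⇔ (λ p → contradiction p ¬p) (λ 1+k≤c → contradiction (ℕ.≤-trans 1+k≤c c≤k) (ℕ.n≮n k))
    where
    c≤k : countUpTo (suc k) ≤ k
    c≤k = ℕ.≤-trans (ℕ.≤-reflexive (countUpTo-reject k ¬p)) (countUpTo≤ k)

isqrt-spec : ∀ n {r} → 1 ≤ r → r ≤ n → r ℕ.* r ≤ n ⇔ r ≤ isqrt n
isqrt-spec n = P⇔≤countUpTo (λ r → r ℕ.* r ≤? n) (λ i≤j j²≤n → ℕ.≤-trans (square-mono i≤j) j²≤n) n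

isqrt²≤ : ∀ {n} → 1 ≤ n → isqrt n ℕ.* isqrt n ≤ n
isqrt²≤ {n} 1≤n = Equivalence.from (isqrt-spec n 1≤√n (countUpTo≤ (λ r → r ℕ.* r ≤? n) n)) ℕ.≤-refl
  where
  1≤√n : 1 ≤ isqrt n
  1≤√n = Equivalence.to (isqrt-spec n ℕ.≤-refl 1≤n) 1≤n

≤isqrt : ∀ {n i} → 1 ≤ i → i ℕ.* i ≤ n → i ≤ isqrt n
≤isqrt {n} {i@(suc _)} 1≤i i²≤n = Equivalence.to (isqrt-spec n 1≤i (ℕ.≤-trans (ℕ.m≤m*n i i) i²≤n)) i²≤n

primeCount≡∑ : ∀ n → + primeCount n ≡ ∑[ k < n ] 𝟙 (prime? (suc k))
primeCount≡∑ n = trans (length-filter-applyUpTo prime? (λ k → k) (suc n)) (ℤ.+-identityˡ _)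

alternatingSum : ℕ → List ℕ → ℕ → ℤ
alternatingSum n R K = ∑[ s < suc K ] sign s * sumℤ (map (term n) (choose s R))

alternatingSum≡primeCount+1 : ∀ n R → AllPairs _≤_ R → All (2 ≤_) R → All (λ i → i ℕ.* i ≤ n) R →
  (∀ {i} → 2 ≤ i → i ℕ.* i ≤ n → i ∈ R) → ∀ K → length R ≤ K → 1 ≤ n →
  alternatingSum n R K ≡ + primeCount n + + 1
alternatingSum≡primeCount+1 n@(suc n′) R sorted 2≤R i²≤n covers K |R|≤K _ = begin
  ∑[ s < suc K ] sign s * sumℤ (map (term n) (choose s R))
    ≡⟨ ∑-cong (suc K) (λ s _ → cong (sign s *_) (sumℤ-term s)) ⟩
  ∑[ s < suc K ] sign s * (∑[ k < n ] elementary (c k) R s)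
    ≡⟨ ∑-cong (suc K) (λ s _ → *-distribˡ-∑ (sign s) n (λ k → elementary (c k) R s)) ⟩
  ∑[ s < suc K ] ∑[ k < n ] sign s * elementary (c k) R s
    ≡⟨ ∑-comm (suc K) n (λ s k → sign s * elementary (c k) R s) ⟩
  ∑[ k < n ] ∑[ s < suc K ] sign s * elementary (c k) R s
    ≡⟨ ∑-cong n (λ k _ → inclusion-exclusion (c k) R K |R|≤K) ⟩
  ∑[ k < n ] productℤ (map (λ i → + 1 - c k i) R)
    ≡⟨ ∑-cong n (λ k k<n → productℤ-unmarked R 2≤R covers (s≤s z≤n) k<n) ⟩
  ∑[ k < n ] (𝟙 (prime? (suc k)) + 𝟙 (suc k ≟ 1))
    ≡⟨ ∑-distrib-+ n (λ k → 𝟙 (prime? (suc k))) (λ k → 𝟙 (suc k ≟ 1)) ⟩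
  (∑[ k < n ] 𝟙 (prime? (suc k))) + (∑[ k < n ] 𝟙 (suc k ≟ 1))
    ≡⟨ cong₂ _+_ (sym (primeCount≡∑ n)) (cong (_+_ (+ 1)) (∑-zero n′ (λ _ _ → refl))) ⟩
  + primeCount n + + 1 ∎
  where
  c : ℕ → ℕ → ℤ
  c k = 𝟙 ∘ marked? (suc k)
  term≡ : ∀ {S} → S ⊆ R → term n S ≡ ∑[ k < n ] productℤ (map (c k) S)
  term≡ {S} S⊆R = term≡∑-allMarked n S (AllPairs-resp-⊆ S⊆R sorted)
    (All.map ℕ.<⇒≤ (All-resp-⊆ S⊆R 2≤R)) (All-resp-⊆ S⊆R i²≤n)
  sumℤ-term : ∀ s → sumℤ (map (term n) (choose s R)) ≡ ∑[ k < n ] elementary (c k) R s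
  sumℤ-term s = trans (cong sumℤ (List.map-cong-local (All.map term≡ (choose-⊆ s R))))
                      (sumℤ-map-∑ (λ S k → productℤ (map (c k) S)) (choose s R) n)

lcm-identityʳ : ∀ i → lcm i 1 ≡ i
lcm-identityʳ i = ∣-antisym (lcm-least ∣-refl (1∣ i)) (m∣lcm[m,n] i 1)

term-[] : ∀ n → term n [] ≡ + n
term-[] n = trans (ℤ.+-identityʳ (+ (n / 1))) (cong +_ (n/1≡n n))

term-singleton : ∀ n j → term n [ suc j ] ≡ (+ (n div suc j) - + suc j) + + 1
term-singleton n j = begin
  term n [ suc j ]
    ≡⟨ cong (λ L → + (n div L) - + ((suc j ℕ.* suc j ∸ 1) div L)) (lcm-identityʳ (suc j)) ⟩
  + (n div suc j) - + ((j ℕ.+ j ℕ.* suc j) / suc j)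
    ≡⟨ cong (λ q → + (n div suc j) - + q) [j+j*[1+j]]/[1+j]≡j ⟩
  + (n div suc j) - + j
    ≡⟨ shift (+ (n div suc j)) (+ j) ⟩
  (+ (n div suc j) - + suc j) + + 1 ∎
  where
  [j+j*[1+j]]/[1+j]≡j : (j ℕ.+ j ℕ.* suc j) / suc j ≡ j
  [j+j*[1+j]]/[1+j]≡j = trans (+-distrib-/-∣ʳ j (n∣m*n j))
    (cong₂ ℕ._+_ (m<n⇒m/n≡0 (ℕ.n<1+n j)) (m*n/n≡m j (suc j)))
  shift : ∀ a b → a - b ≡ (a - (+ 1 + b)) + + 1
  shift = solve-∀

rhsAt : ℕ → ℕ → ℤ
rhsAt n m =
  ((+ n) - (+ 1))
  - sumℤ (map (λ i → ((+ (n div i)) - (+ i)) + (+ 1)) (range 2 m))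
  + sumℤ (map (λ s → sign s * sumℤ (map (term n) (choose s (range 2 m)))) (range 2 m))

rhsAt≡alternatingSum-1 : ∀ n m′ →
  rhsAt n (suc m′) ≡ alternatingSum n (range 2 (suc m′)) (suc m′) - + 1
rhsAt≡alternatingSum-1 n m′ = begin
  ((+ n - + 1) - sumℤ (map g R)) + sumℤ (map h R)
    ≡⟨ cong₂ (λ G H → ((+ n - + 1) - G) + H)
             (sumℤ-map-applyUpTo g (2 ℕ.+_) m′) (sumℤ-map-applyUpTo h (2 ℕ.+_) m′) ⟩
  ((+ n - + 1) - G) + H
    ≡⟨ rearrange (+ n) G H ⟩
  (+ 1 * (+ n + + 0) + (- + 1 * G + H)) - + 1
    ≡⟨ cong₂ (λ N G′ → (+ 1 * (N + + 0) + (- + 1 * G′ + H)) - + 1) (term-[] n) sumℤ-singletons ⟨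
  ∑ (suc (suc m′)) h - + 1 ∎
  where
  R = range 2 (suc m′)
  g : ℕ → ℤ
  g i = (+ (n div i) - + i) + + 1
  h : ℕ → ℤ
  h s = sign s * sumℤ (map (term n) (choose s R))
  G = ∑[ i < m′ ] g (2 ℕ.+ i)
  H = ∑[ s < m′ ] h (2 ℕ.+ s)
  sumℤ-singletons : sumℤ (map (term n) (choose 1 R)) ≡ G
  sumℤ-singletons = begin
    sumℤ (map (term n) (choose 1 R))    ≡⟨ cong (sumℤ ∘ map (term n)) (choose-1 R) ⟩
    sumℤ (map (term n) (map [_] R))     ≡⟨ cong sumℤ (List.map-∘ R) ⟨
    sumℤ (map (term n ∘ [_]) R)         ≡⟨ sumℤ-map-applyUpTo (term n ∘ [_]) (2 ℕ.+_) m′ ⟩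
    ∑[ i < m′ ] term n [ 2 ℕ.+ i ]      ≡⟨ ∑-cong m′ (λ i _ → term-singleton n (suc i)) ⟩
    G                                   ∎
  -- the target is ∑ (suc (suc m′)) h − 1 with the terms h 0 and h 1 unfolded
  rearrange : ∀ N G H → ((N - + 1) - G) + H ≡ (+ 1 * (N + + 0) + (- + 1 * G + H)) - + 1
  rearrange = solve-∀

primeCount≡rhsAt : ∀ n m → 1 ≤ n → m ℕ.* m ≤ n → (∀ {i} → 1 ≤ i → i ℕ.* i ≤ n → i ≤ m) →
  + primeCount n ≡ rhsAt n m
primeCount≡rhsAt n zero      1≤n _    maximal = contradiction (maximal ℕ.≤-refl 1≤n) (ℕ.<⇒≱ ℕ.≤-refl)
primeCount≡rhsAt n (suc m′) 1≤n m²≤n maximal = begin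
  + primeCount n                        ≡⟨ cancel (+ primeCount n) ⟨
  (+ primeCount n + + 1) - + 1          ≡⟨ cong (_- + 1) alternatingSum≡ ⟨
  alternatingSum n R (suc m′) - + 1     ≡⟨ rhsAt≡alternatingSum-1 n m′ ⟨
  rhsAt n (suc m′)                      ∎
  where
  R = range 2 (suc m′)
  sorted : AllPairs _≤_ R
  sorted = AllPairs.applyUpTo⁺₁ (2 ℕ.+_) m′ (λ i<j _ → s≤s (s≤s (ℕ.<⇒≤ i<j)))
  2≤R : All (2 ≤_) R
  2≤R = All.applyUpTo⁺₂ (2 ℕ.+_) m′ (λ _ → s≤s (s≤s z≤n))
  i²≤n : All (λ i → i ℕ.* i ≤ n) R
  i²≤n = All.applyUpTo⁺₁ (2 ℕ.+_) m′ (λ i<m′ → ℕ.≤-trans (square-mono (s≤s i<m′)) m²≤n)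
  covers : ∀ {i} → 2 ≤ i → i ℕ.* i ≤ n → i ∈ R
  covers {suc zero} (s≤s ()) _
  covers {suc (suc t)} _ i²≤n = ∈-applyUpTo⁺ (2 ℕ.+_) (ℕ.≤-pred (maximal (s≤s z≤n) i²≤n))
  |R|≤1+m′ : length R ≤ suc m′
  |R|≤1+m′ = ℕ.≤-trans (ℕ.≤-reflexive (List.length-applyUpTo (2 ℕ.+_) m′)) (ℕ.n≤1+n m′)
  alternatingSum≡ : alternatingSum n R (suc m′) ≡ + primeCount n + + 1
  alternatingSum≡ = alternatingSum≡primeCount+1 n R sorted 2≤R i²≤n covers (suc m′) |R|≤1+m′ 1≤n
  cancel : ∀ p → (p + + 1) - + 1 ≡ p
  cancel = solve-∀

mainTheorem1 : (n : ℕ) → n ≥ 1 → + (primeCount n) ≡ rhs n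
mainTheorem1 n 1≤n = primeCount≡rhsAt n (isqrt n) 1≤n (isqrt²≤ 1≤n) ≤isqrt
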